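{- Let $f:L\to M$ be a symmetrizable function between o-algebras. Then the following conditions are equivalent: (1) if $f x_1\bowtie f x_2$, then $x_1\bowtie x_2$; (2) $f$ preserves binary meets; (3) $f^\dagger f x\leq x$ for every $x$. Moreover the following are equivalent: (4) if $x_1\bowtie x_2$, then $f x_1\bowtie f x_2$; (5) if $\mathrm{Pos}(x)$, then $\mathrm{Pos}(fx)$; (6) $f^\dagger 1=1$; (7) $x\leq f^\dagger f x$ for every $x$.
   Context: Work in intuitionistic logic without choice. A positivity predicate on a complete lattice $L$ is a unary predicate $\mathrm{Pos}$ such that: (i) $\mathrm{Pos}(x)$ and $x\le y$ imply $\mathrm{Pos}(y)$; (ii) $\mathrm{Pos}(\bigvee X)$ implies $\mathrm{Pos}(x)$ for some $x\in X$; (iii) if $\mathrm{Pos}(x)\Rightarrow x\le y$, then $x\le y$. An o-algebra is a frame $L$ with a positivity predicate such that for all $x,y$: if $\mathrm{Pos}(z\wedge x)\Rightarrow\mathrm{Pos}(z\wedge y)$ for every $z\in L$, then $x\le y$. Write $x\bowtie y$ (overlap) for $\mathrm{Pos}(x\wedge y)$. Functions $f:L\to M$, $g:M\to L$ between o-algebras are symmetric if $f(x)\bowtie y\iff x\bowtie g(y)$ for all $x\in L$, $y\in M$; $f$ is symmetrizable if it has a (necessarily unique) symmetric, denoted $f^\dagger$. -}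

module Defs where

open import Level using (Level; _⊔_) renaming (suc to lsuc)
open import Data.Product using (Σ; _×_; _,_; proj₁)
open import Relation.Binary.PropositionalEquality using (_≡_)
open import Relation.Binary.Structures using (IsPartialOrder)
open import Function.Bundles using (_⇔_)

-- Subsets of the carrier are predicates
-- Carrier → Set c; equality of elements is propositional equality and
-- ≤ is a partial order with respect to it.
record OAlgebra (c ℓ : Level) : Set (lsuc (c ⊔ ℓ)) where
  infix 4 _≤_
  infixr 7 _∧_
  field
    Carrier : Set c
    _≤_     : Carrier → Carrier → Set ℓ
    isPartialOrder : IsPartialOrder _≡_ _≤_
    ⋁       : (Carrier → Set c) → Carrier
    ⋁-upper : ∀ (X : Carrier → Set c) x → X x → x ≤ ⋁ X
    ⋁-least : ∀ (X : Carrier → Set c) y → (∀ x → X x → x ≤ y) → ⋁ X ≤ y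
    _∧_     : Carrier → Carrier → Carrier
    ∧-lb₁   : ∀ x y → x ∧ y ≤ x
    ∧-lb₂   : ∀ x y → x ∧ y ≤ y
    ∧-glb   : ∀ x y z → z ≤ x → z ≤ y → z ≤ x ∧ y
    𝟙       : Carrier
    𝟙-max   : ∀ x → x ≤ 𝟙
    -- frame distributivity: x ∧ ⋁ X ≤ ⋁ { x ∧ y | y ∈ X }
    distrib : ∀ x (X : Carrier → Set c) →
              x ∧ ⋁ X ≤ ⋁ (λ z → Σ Carrier (λ y → X y × (z ≡ x ∧ y)))
    Pos     : Carrier → Set ℓ
    Pos-mono : ∀ x y → Pos x → x ≤ y → Pos y
    Pos-⋁    : ∀ (X : Carrier → Set c) → Pos (⋁ X) → Σ Carrier (λ x → X x × Pos x)
    Pos-pos  : ∀ x y → (Pos x → x ≤ y) → x ≤ y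
    o-cond  : ∀ x y → (∀ z → Pos (z ∧ x) → Pos (z ∧ y)) → x ≤ y

  _⋈_ : Carrier → Carrier → Set ℓ
  x ⋈ y = Pos (x ∧ y)

open OAlgebra public using (Carrier)

module _ {c₁ ℓ₁ c₂ ℓ₂ : Level} (L : OAlgebra c₁ ℓ₁) (M : OAlgebra c₂ ℓ₂) where
  private
    module L = OAlgebra L
    module M = OAlgebra M

  Symmetric : (L.Carrier → M.Carrier) → (M.Carrier → L.Carrier) → Set (c₁ ⊔ c₂ ⊔ ℓ₁ ⊔ ℓ₂)
  Symmetric f g = ∀ x y → (f x M.⋈ y) ⇔ (x L.⋈ g y)

  Symmetrizable : (L.Carrier → M.Carrier) → Set (c₁ ⊔ c₂ ⊔ ℓ₁ ⊔ ℓ₂)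
  Symmetrizable f = Σ (M.Carrier → L.Carrier) (λ g → Symmetric f g)

  module _ (f : L.Carrier → M.Carrier) (s : Symmetrizable f) where
    f† : M.Carrier → L.Carrier
    f† = proj₁ s

    Cond1 : Set (c₁ ⊔ ℓ₁ ⊔ ℓ₂)
    Cond1 = ∀ x₁ x₂ → f x₁ M.⋈ f x₂ → x₁ L.⋈ x₂
    Cond2 : Set (c₁ ⊔ c₂)
    Cond2 = ∀ x y → f (x L.∧ y) ≡ f x M.∧ f y
    Cond3 : Set (c₁ ⊔ ℓ₁)
    Cond3 = ∀ x → f† (f x) L.≤ x
    Cond4 : Set (c₁ ⊔ ℓ₁ ⊔ ℓ₂)
    Cond4 = ∀ x₁ x₂ → x₁ L.⋈ x₂ → f x₁ M.⋈ f x₂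
    Cond5 : Set (c₁ ⊔ ℓ₁ ⊔ ℓ₂)
    Cond5 = ∀ x → L.Pos x → M.Pos (f x)
    Cond6 : Set c₁
    Cond6 = f† M.𝟙 ≡ L.𝟙
    Cond7 : Set (c₁ ⊔ ℓ₁)
    Cond7 = ∀ x → x L.≤ f† (f x)

-- Everything is reduced to overlaps x ⋈ y = Pos (x ∧ y): the
-- o-algebra condition says that x ≤ y as soon as every z overlapping x
-- also overlaps y, and symmetry f x ⋈ y ⇔ x ⋈ g y lets overlaps move
-- across f.
module Submission where

open import Defs
open import Level using (Level)
open import Data.Product using (_×_; _,_)
open import Function.Bundles using (_⇔_; mk⇔; Equivalence)
open import Relation.Binary.PropositionalEquality using (_≡_; subst; sym)
open import Relation.Binary.Structures using (IsPartialOrder)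

-- A cycle of implications makes all its members equivalent.  The cycles
-- are written in the orientation in which they are proved below.
cycle₃ : ∀ {a b c} {A : Set a} {B : Set b} {C : Set c} →
         (B → A) → (C → B) → (A → C) → (A ⇔ B) × (B ⇔ C)
cycle₃ b⇒a c⇒b a⇒c =
  mk⇔ (λ a → c⇒b (a⇒c a)) b⇒a , mk⇔ (λ b → a⇒c (b⇒a b)) c⇒b

cycle₄ : ∀ {a b c d} {A : Set a} {B : Set b} {C : Set c} {D : Set d} →
         (B → A) → (C → B) → (D → C) → (A → D) →
         (A ⇔ B) × (B ⇔ C) × (C ⇔ D)
cycle₄ b⇒a c⇒b d⇒c a⇒d =
    mk⇔ (λ a → c⇒b (d⇒c (a⇒d a))) b⇒a
  , mk⇔ (λ b → d⇒c (a⇒d (b⇒a b))) c⇒b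
  , mk⇔ (λ c → a⇒d (b⇒a (c⇒b c))) d⇒c

module Overlap {c ℓ : Level} (A : OAlgebra c ℓ) where
  open OAlgebra A public
  open IsPartialOrder isPartialOrder public
    using () renaming (refl to ≤-refl; trans to ≤-trans; antisym to ≤-antisym)

  Pos-≤ : ∀ {x y} → x ≤ y → Pos x → Pos y
  Pos-≤ {x} {y} x≤y p = Pos-mono x y p x≤y

  ∧-mono : ∀ {x y x′ y′} → x ≤ x′ → y ≤ y′ → x ∧ y ≤ x′ ∧ y′
  ∧-mono {x} {y} {x′} {y′} x≤x′ y≤y′ =
    ∧-glb x′ y′ (x ∧ y) (≤-trans (∧-lb₁ x y) x≤x′) (≤-trans (∧-lb₂ x y) y≤y′)

  monotone-∧ : ∀ {c′ ℓ′} {B : OAlgebra c′ ℓ′} (h : OAlgebra.Carrier B → OAlgebra.Carrier A) →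
               (∀ {u v} → OAlgebra._≤_ B u v → h u ≤ h v) →
               ∀ u v → h (OAlgebra._∧_ B u v) ≤ h u ∧ h v
  monotone-∧ {B = B} h h-mono u v =
    ∧-glb (h u) (h v) _ (h-mono (OAlgebra.∧-lb₁ B u v)) (h-mono (OAlgebra.∧-lb₂ B u v))

  ≤-from-⋈ : ∀ {x y} → (∀ z → z ⋈ x → z ⋈ y) → x ≤ y
  ≤-from-⋈ {x} {y} = o-cond x y

  ⋈-sym : ∀ {x y} → x ⋈ y → y ⋈ x
  ⋈-sym {x} {y} = Pos-≤ (∧-glb y x (x ∧ y) (∧-lb₂ x y) (∧-lb₁ x y))

  ⋈-mono : ∀ {x y x′ y′} → x ≤ x′ → y ≤ y′ → x ⋈ y → x′ ⋈ y′
  ⋈-mono x≤x′ y≤y′ = Pos-≤ (∧-mono x≤x′ y≤y′)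

  -- x ⋈ (y ∧ z) only concerns the meet of x, y and z, so x and y may swap.
  ⋈-exchange : ∀ {x y z} → x ⋈ (y ∧ z) → y ⋈ (x ∧ z)
  ⋈-exchange {x} {y} {z} = Pos-≤ (∧-glb y (x ∧ z) _
    (≤-trans (∧-lb₂ x (y ∧ z)) (∧-lb₁ y z)) (∧-mono ≤-refl (∧-lb₂ y z)))

  ⋈⇒Pos : ∀ {x y} → x ⋈ y → Pos x
  ⋈⇒Pos {x} {y} = Pos-≤ (∧-lb₁ x y)

  Pos⇒⋈𝟙 : ∀ {x} → Pos x → x ⋈ 𝟙
  Pos⇒⋈𝟙 {x} = Pos-≤ (∧-glb x 𝟙 x ≤-refl (𝟙-max x))

module SymmetricPair {c₁ ℓ₁ c₂ ℓ₂ : Level} (L : OAlgebra c₁ ℓ₁) (M : OAlgebra c₂ ℓ₂)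
    (f : Carrier L → Carrier M) (g : Carrier M → Carrier L)
    (f⋈g : Symmetric L M f g) where
  module L = Overlap L
  module M = Overlap M

  ⋈-left : ∀ {x y} → f x M.⋈ y → x L.⋈ g y
  ⋈-left {x} {y} = Equivalence.to (f⋈g x y)

  ⋈-right : ∀ {x y} → x L.⋈ g y → f x M.⋈ y
  ⋈-right {x} {y} = Equivalence.from (f⋈g x y)

  f-mono : ∀ {x x′} → x L.≤ x′ → f x M.≤ f x′
  f-mono x≤x′ = M.≤-from-⋈ λ z z⋈fx →
    M.⋈-sym (⋈-right (L.⋈-mono x≤x′ L.≤-refl (⋈-left (M.⋈-sym z⋈fx))))

  g-mono : ∀ {y y′} → y M.≤ y′ → g y L.≤ g y′
  g-mono y≤y′ = L.≤-from-⋈ λ z z⋈gy →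
    ⋈-left (M.⋈-mono M.≤-refl y≤y′ (⋈-right z⋈gy))

  f-∧ : ∀ x y → f (x L.∧ y) M.≤ f x M.∧ f y
  f-∧ = M.monotone-∧ {B = L} f f-mono

  frobenius : ∀ x y → f x M.∧ y M.≤ f (x L.∧ g y)
  frobenius x y = M.≤-from-⋈ λ w w⋈fx∧y →
    let x⋈gw∧gy : x L.⋈ (g w L.∧ g y)
        x⋈gw∧gy = L.⋈-mono L.≤-refl (L.monotone-∧ {B = M} g g-mono w y)
                    (⋈-left (M.⋈-exchange w⋈fx∧y))
    in M.⋈-sym (⋈-right (L.⋈-sym (L.⋈-exchange x⋈gw∧gy)))

  Pos-f⇒⋈g𝟙 : ∀ {x} → M.Pos (f x) → x L.⋈ g M.𝟙
  Pos-f⇒⋈g𝟙 p = ⋈-left (M.Pos⇒⋈𝟙 p)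

  ⋈g𝟙⇒Pos-f : ∀ {x} → x L.⋈ g M.𝟙 → M.Pos (f x)
  ⋈g𝟙⇒Pos-f x⋈g𝟙 = M.⋈⇒Pos (⋈-right x⋈g𝟙)

  Pos-reflect : ∀ {x} → M.Pos (f x) → L.Pos x
  Pos-reflect p = L.⋈⇒Pos (Pos-f⇒⋈g𝟙 p)

  private
    s : Symmetrizable L M f
    s = g , f⋈g

  cond1⇒cond3 : Cond1 L M f s → Cond3 L M f s
  cond1⇒cond3 reflect x = L.≤-from-⋈ λ z z⋈gfx → reflect z x (⋈-right z⋈gfx)

  cond3⇒cond2 : Cond3 L M f s → Cond2 L M f s
  cond3⇒cond2 gf≤id x y = M.≤-antisym (f-∧ x y)
    (M.≤-trans (frobenius x (f y)) (f-mono (L.∧-mono L.≤-refl (gf≤id y))))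

  cond2⇒cond1 : Cond2 L M f s → Cond1 L M f s
  cond2⇒cond1 f-meet x₁ x₂ fx₁⋈fx₂ =
    Pos-reflect (subst M.Pos (sym (f-meet x₁ x₂)) fx₁⋈fx₂)

  cond4⇒cond7 : Cond4 L M f s → Cond7 L M f s
  cond4⇒cond7 preserve x = L.≤-from-⋈ λ z z⋈x → ⋈-left (preserve z x z⋈x)

  cond7⇒cond6 : Cond7 L M f s → Cond6 L M f s
  cond7⇒cond6 id≤gf = L.≤-antisym (L.𝟙-max _)
    (L.≤-trans (id≤gf L.𝟙) (g-mono (M.𝟙-max (f L.𝟙))))

  cond6⇒cond5 : Cond6 L M f s → Cond5 L M f s
  cond6⇒cond5 g𝟙≡𝟙 x p =
    ⋈g𝟙⇒Pos-f (subst (x L.⋈_) (sym g𝟙≡𝟙) (L.Pos⇒⋈𝟙 p))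

  cond5⇒cond4 : Cond5 L M f s → Cond4 L M f s
  cond5⇒cond4 preserve-Pos x₁ x₂ x₁⋈x₂ =
    M.Pos-≤ (f-∧ x₁ x₂) (preserve-Pos (x₁ L.∧ x₂) x₁⋈x₂)

proposition3p8 : {c₁ ℓ₁ c₂ ℓ₂ : Level} (L : OAlgebra c₁ ℓ₁) (M : OAlgebra c₂ ℓ₂)
    (f : Carrier L → Carrier M) (s : Symmetrizable L M f) →
    ((Cond1 L M f s ⇔ Cond2 L M f s) × (Cond2 L M f s ⇔ Cond3 L M f s))
    × ((Cond4 L M f s ⇔ Cond5 L M f s) × (Cond5 L M f s ⇔ Cond6 L M f s)
       × (Cond6 L M f s ⇔ Cond7 L M f s))
proposition3p8 L M f (g , f⋈g) =
    cycle₃ cond2⇒cond1 cond3⇒cond2 cond1⇒cond3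
  , cycle₄ cond5⇒cond4 cond6⇒cond5 cond7⇒cond6 cond4⇒cond7
  where open SymmetricPair L M f g f⋈g
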